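{- Let $s$ be the Fibonacci word of even order $2k>4$ and $n=|s|$. Let $s'$ be the word obtained from $s$ by substituting the ${\tt b}$ at position $F_{2k}-1$ (the last position) by an ${\tt a}$, i.e. $s'=s[0..n-2]{\tt a}$. Then $\mathrm{BWT}(s')$ has $2k+2$ runs.
   Context: Alphabet $\{{\tt a},{\tt b}\}$ with ${\tt a}<{\tt b}$; words indexed from $0$. $\mathrm{BWT}(w)$: sort the conjugates $w[i..n-1]w[0..i-1]$ of $w$ lexicographically and concatenate their last characters. A run is a maximal equal-letter factor. Fibonacci words: $s_0={\tt b}$, $s_1={\tt a}$, $s_{i+1}=s_is_{i-1}$ ($i\ge1$), $s_i$ has order $i$; $F_i=|s_i|$ ($F_0=F_1=1$, $F_{i+1}=F_i+F_{i-1}$). -}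

module Defs where

open import Data.Nat using (ℕ; zero; suc; _+_)
open import Data.Bool using (Bool; true; false)
open import Data.List using (List; []; _∷_; _++_; length; map; reverse)

data Letter : Set where
  a b : Letter

Word : Set
Word = List Letter

fibWord : ℕ → Word
fibWord zero = b ∷ []
fibWord (suc zero) = a ∷ []
fibWord (suc (suc i)) = fibWord (suc i) ++ fibWord i

-- F_i = |s_i|
F : ℕ → ℕ
F zero = 1
F (suc zero) = 1
F (suc (suc i)) = F (suc i) + F i

_≤L_ : Letter → Letter → Bool
a ≤L _ = true
b ≤L a = false
b ≤L b = true

_==L_ : Letter → Letter → Bool
a ==L a = true
b ==L b = true
_ ==L _ = false

lexLeq : Word → Word → Bool
lexLeq [] _ = true
lexLeq (_ ∷ _) [] = false
lexLeq (x ∷ xs) (y ∷ ys) with x ==L y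
... | true = lexLeq xs ys
... | false = x ≤L y

insert : Word → List Word → List Word
insert w [] = w ∷ []
insert w (v ∷ vs) with lexLeq w v
... | true = w ∷ v ∷ vs
... | false = v ∷ insert w vs

sort : List Word → List Word
sort [] = []
sort (w ∷ ws) = insert w (sort ws)

rot : Word → Word
rot [] = []
rot (x ∷ xs) = xs ++ (x ∷ [])

rotsN : ℕ → Word → List Word
rotsN zero _ = []
rotsN (suc m) w = w ∷ rotsN m (rot w)

conjugates : Word → List Word
conjugates w = rotsN (length w) w

lastL : Word → List Letter
lastL [] = []
lastL (x ∷ []) = x ∷ []
lastL (_ ∷ y ∷ ys) = lastL (y ∷ ys)

concatLast : List Word → Word
concatLast [] = []
concatLast (w ∷ ws) = lastL w ++ concatLast ws

BWT : Word → Word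
BWT w = concatLast (sort (conjugates w))

runsFrom : Letter → Word → ℕ
runsFrom _ [] = 1
runsFrom x (y ∷ ys) with x ==L y
... | true = runsFrom y ys
... | false = suc (runsFrom y ys)

runs : Word → ℕ
runs [] = 0
runs (x ∷ xs) = runsFrom x xs

dropLast : Word → Word
dropLast [] = []
dropLast (_ ∷ []) = []
dropLast (x ∷ y ∷ ys) = x ∷ dropLast (y ∷ ys)

{-# OPTIONS --safe #-}

-- Write k = J + 1 and s′ = u ∷ʳ a, where u = fibInit J is the Fibonacci word of order 2J + 2 without its
-- last letter. A conjugate of s′ other than s′ itself has the form v ++ a ∷ p ∷ʳ x with u = p ++ x ∷ v.
-- Since u is obtained by iterating w ↦ φ² w ∷ʳ a and φ² preserves mismatches, every such suffix v is
-- empty, a border fibInit j (j < J) preceded by a, or mismatches u: from below when preceded by b and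
-- from above when preceded by a. So every conjugate from s′ on ends in a, and the a-ending conjugates
-- below s′ are exactly the k words a ∷ u and v ++ a ∷ p ∷ʳ a for the J borders v. Sorted, these k words
-- are separated by b-ending conjugates, so the BWT reads b⁺ a b⁺ a ⋯ a b⁺ a⁺ and has 2k + 2 runs.
module Submission where

open import Defs
open import Data.Nat using (ℕ; _<_; _+_; _*_)
open import Data.List using (_∷_; []; _++_)
open import Relation.Binary.PropositionalEquality using (_≡_)

open import Data.Bool using (true; false; if_then_else_)
open import Data.Empty using (⊥; ⊥-elim)
open import Function using (_∘_)
open import Data.List using (List; length; map; _∷ʳ_; take; drop; initLast; _∷ʳ′_)
open import Data.List.Properties
  using (∷-injectiveʳ; ++-assoc; ++-cancelʳ; ++-identityʳ; ∷ʳ-++; ∷ʳ-injective; ∷ʳ-injectiveʳ; map-∘)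
open import Data.List.Properties using (length-++; length-++-≤ˡ; length-take; take++drop≡id)
open import Data.List.Membership.Propositional using (_∈_)
open import Data.List.Membership.Propositional.Properties using (∈-map⁺)
open import Data.List.Relation.Unary.All as All using (All; []; _∷_)
import Data.List.Relation.Unary.All.Properties as All
open import Data.List.Relation.Unary.Any using (here; there)
open import Data.List.Relation.Unary.Linked using (Linked; []; [-]; _∷_)
open import Data.List.Relation.Binary.Permutation.Propositional
  using (_↭_; ↭-refl; ↭-prep; ↭-swap; ↭-trans; ↭-sym)
open import Data.List.Relation.Binary.Permutation.Propositional.Properties using (∈-resp-↭)
open import Data.Nat using (zero; suc; _≤_; _∸_; z≤n; s≤s)
open import Data.Nat.Properties
  using (≤-refl; ≤-trans; ≤-pred; <-irrefl; <-≤-trans; n≤1+n; m≤n+m; m<1+n⇒m≤n; m≤n⇒m<n∨m≡n; m≤n⇒m⊓n≡m)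
open import Data.Nat.Properties
  using (+-comm; +-suc; +-identityʳ; +-mono-≤; +-monoˡ-≤; *-monoʳ-≤; n∸n≡0; +-∸-assoc)
open import Data.Product using (∃-syntax; _×_; _,_; proj₁; proj₂)
open import Data.Sum using (inj₁; inj₂)
open import Relation.Binary.PropositionalEquality using (_≢_; refl; sym; trans; cong; cong₂; subst; subst₂)
open Relation.Binary.PropositionalEquality.≡-Reasoning

infix 4 _≤ˡ_ _<ˡ_ _≺_

_≤ˡ_ : Word → Word → Set
u ≤ˡ v = lexLeq u v ≡ true

_<ˡ_ : Word → Word → Set
u <ˡ v = lexLeq v u ≡ false

≤ˡ-refl : ∀ u → u ≤ˡ u
≤ˡ-refl []      = refl
≤ˡ-refl (a ∷ u) = ≤ˡ-refl u
≤ˡ-refl (b ∷ u) = ≤ˡ-refl u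

≤ˡ-trans : ∀ u v w → u ≤ˡ v → v ≤ˡ w → u ≤ˡ w
≤ˡ-trans []      _       _       _ _ = refl
≤ˡ-trans (_ ∷ _) []      _       () _
≤ˡ-trans (_ ∷ _) (_ ∷ _) []      _ ()
≤ˡ-trans (a ∷ u) (a ∷ v) (a ∷ w) p q = ≤ˡ-trans u v w p q
≤ˡ-trans (a ∷ u) (a ∷ v) (b ∷ w) p q = refl
≤ˡ-trans (a ∷ u) (b ∷ v) (b ∷ w) p q = refl
≤ˡ-trans (b ∷ u) (b ∷ v) (b ∷ w) p q = ≤ˡ-trans u v w p q
≤ˡ-trans (a ∷ u) (b ∷ v) (a ∷ w) p ()
≤ˡ-trans (b ∷ u) (a ∷ v) _       () q
≤ˡ-trans (b ∷ u) (b ∷ v) (a ∷ w) p ()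

≤ˡ-antisym : ∀ u v → u ≤ˡ v → v ≤ˡ u → u ≡ v
≤ˡ-antisym []      []      p q = refl
≤ˡ-antisym []      (_ ∷ _) p ()
≤ˡ-antisym (_ ∷ _) []      () q
≤ˡ-antisym (a ∷ u) (a ∷ v) p q = cong (a ∷_) (≤ˡ-antisym u v p q)
≤ˡ-antisym (b ∷ u) (b ∷ v) p q = cong (b ∷_) (≤ˡ-antisym u v p q)
≤ˡ-antisym (a ∷ u) (b ∷ v) p ()
≤ˡ-antisym (b ∷ u) (a ∷ v) () q

<ˡ⇒≤ˡ : ∀ u v → u <ˡ v → u ≤ˡ v
<ˡ⇒≤ˡ u       []      ()
<ˡ⇒≤ˡ []      (_ ∷ _) p = refl
<ˡ⇒≤ˡ (a ∷ u) (a ∷ v) p = <ˡ⇒≤ˡ u v p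
<ˡ⇒≤ˡ (b ∷ u) (b ∷ v) p = <ˡ⇒≤ˡ u v p
<ˡ⇒≤ˡ (a ∷ u) (b ∷ v) p = refl
<ˡ⇒≤ˡ (b ∷ u) (a ∷ v) ()

≤ˡ⇒≯ˡ : ∀ {u v} → u ≤ˡ v → v <ˡ u → ⊥
≤ˡ⇒≯ˡ u≤v v<u with trans (sym u≤v) v<u
... | ()

<ˡ-≤ˡ-trans : ∀ u v w → u <ˡ v → v ≤ˡ w → u <ˡ w
<ˡ-≤ˡ-trans u v w u<v v≤w with lexLeq w u in w?u
... | false = refl
... | true  = ⊥-elim (≤ˡ⇒≯ˡ {v} {u} (≤ˡ-trans v w u v≤w w?u) u<v)

<ˡ-trans : ∀ u v w → u <ˡ v → v <ˡ w → u <ˡ w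
<ˡ-trans u v w p q = <ˡ-≤ˡ-trans u v w p (<ˡ⇒≤ˡ v w q)

-- u ≺ v: u and v first differ where u has a and v has b. Unlike _<ˡ_ this survives
-- arbitrary right extensions (≺-++ʳ), which is what comparing conjugates needs.
data _≺_ : Word → Word → Set where
  this : ∀ {u v} → a ∷ u ≺ b ∷ v
  next : ∀ {x u v} → u ≺ v → x ∷ u ≺ x ∷ v

≺⇒<ˡ : ∀ {u v} → u ≺ v → u <ˡ v
≺⇒<ˡ this           = refl
≺⇒<ˡ (next {a} u≺v) = ≺⇒<ˡ u≺v
≺⇒<ˡ (next {b} u≺v) = ≺⇒<ˡ u≺v

≺-++ʳ : ∀ {u v} X Y → u ≺ v → u ++ X ≺ v ++ Y
≺-++ʳ X Y this        = this
≺-++ʳ X Y (next u≺v) = next (≺-++ʳ X Y u≺v)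

≺-++ˡ : ∀ {u v} z → u ≺ v → z ++ u ≺ z ++ v
≺-++ˡ []      u≺v = u≺v
≺-++ˡ (x ∷ z) u≺v = next (≺-++ˡ z u≺v)

Sorted : List Word → Set
Sorted = Linked _≤ˡ_

insert-sorted : ∀ w {vs} → Sorted vs → Sorted (insert w vs)
insert-sorted w {[]}     _ = [-]
insert-sorted w {v ∷ vs} s with lexLeq w v in w?v
... | true  = w?v ∷ s
... | false = insert-below (<ˡ⇒≤ˡ v w w?v) s
  where
  insert-below : ∀ {v vs} → v ≤ˡ w → Sorted (v ∷ vs) → Sorted (v ∷ insert w vs)
  insert-below v≤w [-] = v≤w ∷ [-]
  insert-below {vs = v′ ∷ _} v≤w (v≤v′ ∷ s) with lexLeq w v′ in w?v′
  ... | true  = v≤w ∷ w?v′ ∷ s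
  ... | false = v≤v′ ∷ insert-below (<ˡ⇒≤ˡ v′ w w?v′) s

sort-sorted : ∀ ws → Sorted (sort ws)
sort-sorted []       = []
sort-sorted (w ∷ ws) = insert-sorted w (sort-sorted ws)

insert-↭ : ∀ w vs → insert w vs ↭ w ∷ vs
insert-↭ w []       = ↭-refl
insert-↭ w (v ∷ vs) with lexLeq w v
... | true  = ↭-refl
... | false = ↭-trans (↭-prep v (insert-↭ w vs)) (↭-swap v w ↭-refl)

sort-↭ : ∀ ws → sort ws ↭ ws
sort-↭ []       = ↭-refl
sort-↭ (w ∷ ws) = ↭-trans (insert-↭ w (sort ws)) (↭-prep w (sort-↭ ws))

parity : ℕ → Letter
parity zero          = b
parity (suc zero)    = a
parity (suc (suc n)) = parity n

runs-∷-same : ∀ x w → runs (x ∷ x ∷ w) ≡ runs (x ∷ w)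
runs-∷-same a w = refl
runs-∷-same b w = refl

runs-∷-parity : ∀ n w → runs (parity n ∷ parity (suc n) ∷ w) ≡ suc (runs (parity (suc n) ∷ w))
runs-∷-parity zero          w = refl
runs-∷-parity (suc zero)    w = refl
runs-∷-parity (suc (suc n)) w = runs-∷-parity n w

head-≤ : ∀ {x m xs} → Linked _≤_ (x ∷ xs) → m ∈ xs → x ≤ m
head-≤ (x≤y ∷ _)  (here refl) = x≤y
head-≤ (x≤y ∷ xs) (there m∈)  = ≤-trans x≤y (head-≤ xs m∈)

runs-parity : ∀ {N x} xs → Linked _≤_ (x ∷ xs) → All (_≤ N) xs → x ≤ N →
  (∀ {m} → x ≤ m → m ≤ N → m ∈ x ∷ xs) → runs (map parity (x ∷ xs)) ≡ suc (N ∸ x)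
runs-parity {x = x} [] _ _ x≤N cover with cover x≤N ≤-refl
... | here refl = cong suc (sym (n∸n≡0 x))
runs-parity {N} {x} (y ∷ ys) (x≤y ∷ sorted) (y≤N ∷ bounded) x≤N cover with m≤n⇒m<n∨m≡n x≤y
... | inj₂ refl = begin
    runs (parity x ∷ parity x ∷ map parity ys)  ≡⟨ runs-∷-same (parity x) _ ⟩
    runs (parity x ∷ map parity ys)             ≡⟨ runs-parity ys sorted bounded x≤N cover′ ⟩
    suc (N ∸ x)                                 ∎
  where
  cover′ : ∀ {m} → x ≤ m → m ≤ N → m ∈ x ∷ ys
  cover′ x≤m m≤N with cover x≤m m≤N
  ... | here m≡x  = here m≡x
  ... | there m∈  = m∈
... | inj₁ x<y with m≤n⇒m<n∨m≡n x<y
...   | inj₂ refl = begin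
    runs (parity x ∷ parity (suc x) ∷ map parity ys)  ≡⟨ runs-∷-parity x _ ⟩
    suc (runs (parity (suc x) ∷ map parity ys))       ≡⟨ cong suc (runs-parity ys sorted bounded y≤N cover′) ⟩
    suc (suc (N ∸ suc x))                             ≡⟨ cong suc (sym (+-∸-assoc 1 y≤N)) ⟩
    suc (N ∸ x)                                       ∎
  where
  cover′ : ∀ {m} → suc x ≤ m → m ≤ N → m ∈ suc x ∷ ys
  cover′ x<m m≤N with cover (≤-trans (n≤1+n x) x<m) m≤N
  ... | here refl = ⊥-elim (<-irrefl refl x<m)
  ... | there m∈  = m∈
...   | inj₁ x+1<y with cover (n≤1+n x) (≤-trans x<y y≤N)
...     | here x+1≡x          = ⊥-elim (<-irrefl (sym x+1≡x) ≤-refl)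
...     | there (here refl)   = ⊥-elim (<-irrefl refl x+1<y)
...     | there (there x+1∈)  = ⊥-elim (<-irrefl refl (<-≤-trans x+1<y (head-≤ sorted x+1∈)))

runs-parity-covering : ∀ {N} ns → Linked _≤_ ns → All (_≤ N) ns → (∀ {m} → m ≤ N → m ∈ ns) →
  runs (map parity ns) ≡ suc N
runs-parity-covering []       _      _   cover with cover z≤n
... | ()
runs-parity-covering (x ∷ xs) sorted (_ ∷ bounded) cover with cover z≤n
... | here refl = runs-parity xs sorted bounded z≤n (λ _ → cover)
... | there 0∈  with head-≤ sorted 0∈
...   | z≤n     = runs-parity xs sorted bounded z≤n (λ _ → cover)

double-suc : ∀ n → 2 * suc n ≡ suc (suc (2 * n))
double-suc n = cong suc (+-suc n (n + 0))

parity-double : ∀ n m → parity (2 * n + m) ≡ parity m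
parity-double zero    m = refl
parity-double (suc n) m = trans (cong (λ k → parity (k + m)) (double-suc n)) (parity-double n m)

countBelow : Word → List Word → ℕ
countBelow w []       = 0
countBelow w (r ∷ rs) = if lexLeq w r then countBelow w rs else suc (countBelow w rs)

countBelow-≤ : ∀ w rs → countBelow w rs ≤ length rs
countBelow-≤ w []       = z≤n
countBelow-≤ w (r ∷ rs) with lexLeq w r
... | true  = ≤-trans (countBelow-≤ w rs) (n≤1+n _)
... | false = s≤s (countBelow-≤ w rs)

countBelow-mono : ∀ {w w′} rs → w ≤ˡ w′ → countBelow w rs ≤ countBelow w′ rs
countBelow-mono []                 _    = z≤n
countBelow-mono {w} {w′} (r ∷ rs) w≤w′ with lexLeq w r in w?r | lexLeq w′ r in w′?r
... | true  | true  = countBelow-mono rs w≤w′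
... | true  | false = ≤-trans (countBelow-mono rs w≤w′) (n≤1+n _)
... | false | false = s≤s (countBelow-mono rs w≤w′)
... | false | true  = ⊥-elim (≤ˡ⇒≯ˡ {w} {r} (≤ˡ-trans w w′ r w≤w′ w′?r) w?r)

countBelow-< : ∀ {w w′} rs → w ∈ rs → w <ˡ w′ → suc (countBelow w rs) ≤ countBelow w′ rs
countBelow-< {w} {w′} (r ∷ rs) (here refl) w<w′ rewrite ≤ˡ-refl w | w<w′ =
  s≤s (countBelow-mono rs (<ˡ⇒≤ˡ w w′ w<w′))
countBelow-< {w} {w′} (r ∷ rs) (there w∈) w<w′ with lexLeq w r in w?r | lexLeq w′ r in w′?r
... | true  | true  = countBelow-< rs w∈ w<w′
... | true  | false = ≤-trans (countBelow-< rs w∈ w<w′) (n≤1+n _)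
... | false | false = s≤s (countBelow-< rs w∈ w<w′)
... | false | true  = ⊥-elim (≤ˡ⇒≯ˡ {w} {r} (≤ˡ-trans w w′ r (<ˡ⇒≤ˡ w w′ w<w′) w′?r) w?r)

countBelow-≡0 : ∀ {w} rs → All (w ≤ˡ_) rs → countBelow w rs ≡ 0
countBelow-≡0 []       []           = refl
countBelow-≡0 (r ∷ rs) (w≤r ∷ w≤rs) rewrite w≤r = countBelow-≡0 rs w≤rs

letterBit : List Letter → ℕ
letterBit (a ∷ []) = 1
letterBit _        = 0

-- If a sorted list consists of b-ending words below θ separated by the a-ending words of R,
-- followed by a-ending words from θ on, its last letters read b⁺ a b⁺ a ⋯ a b⁺ a⁺;
-- block θ R w is the index of the run that contains the last letter of w.
block : Word → List Word → Word → ℕ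
block θ R w = if lexLeq θ w then suc (2 * length R) else 2 * countBelow w R + letterBit (lastL w)

data Placed (θ : Word) (R : List Word) (w : Word) : Set where
  b-below  : lastL w ≡ b ∷ [] → w <ˡ θ → Placed θ R w
  a-marked : lastL w ≡ a ∷ [] → w ∈ R → w <ˡ θ → Placed θ R w
  a-above  : lastL w ≡ a ∷ [] → θ ≤ˡ w → Placed θ R w

block-above : ∀ θ R w → θ ≤ˡ w → block θ R w ≡ suc (2 * length R)
block-above θ R w θ≤w rewrite θ≤w = refl

block-below : ∀ θ R w → w <ˡ θ → block θ R w ≡ 2 * countBelow w R + letterBit (lastL w)
block-below θ R w w<θ rewrite w<θ = refl

letterBit≤1 : ∀ l → letterBit l ≤ 1
letterBit≤1 []          = z≤n
letterBit≤1 (a ∷ [])    = s≤s z≤n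
letterBit≤1 (a ∷ _ ∷ _) = z≤n
letterBit≤1 (b ∷ _)     = z≤n

block-≤ : ∀ θ R w → block θ R w ≤ suc (2 * length R)
block-≤ θ R w with lexLeq θ w
... | true  = ≤-refl
... | false = subst (_≤ suc (2 * length R)) (+-comm (letterBit (lastL w)) _)
                (+-mono-≤ (letterBit≤1 (lastL w)) (*-monoʳ-≤ 2 (countBelow-≤ w R)))

lastL-block : ∀ {θ R w} → Placed θ R w → lastL w ≡ parity (block θ R w) ∷ []
lastL-block {R = R} {w} (b-below last≡b w<θ) rewrite w<θ | last≡b =
  cong (_∷ []) (sym (parity-double (countBelow w R) 0))
lastL-block {R = R} {w} (a-marked last≡a _ w<θ) rewrite w<θ | last≡a =
  cong (_∷ []) (sym (parity-double (countBelow w R) 1))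
lastL-block {R = R} (a-above last≡a θ≤w) rewrite θ≤w | last≡a =
  cong (_∷ []) (sym (trans (cong parity (+-comm 1 (2 * length R))) (parity-double (length R) 1)))

odd<even : ∀ {c c′} → suc c ≤ c′ → 2 * c + 1 ≤ 2 * c′ + 0
odd<even {c} {c′} c<c′ = subst₂ _≤_ (+-comm 1 (2 * c)) (sym (+-identityʳ (2 * c′)))
  (≤-trans (n≤1+n _) (subst (_≤ 2 * c′) (double-suc c) (*-monoʳ-≤ 2 c<c′)))

block-mono : ∀ {θ R w w′} → Placed θ R w → Placed θ R w′ → w ≤ˡ w′ → block θ R w ≤ block θ R w′
block-mono {θ} {R} {w} _ (a-above _ θ≤w′) _ rewrite θ≤w′ = block-≤ θ R w
block-mono {θ} {w = w} {w′} (a-above _ θ≤w) (b-below _ w′<θ) w≤w′ =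
  ⊥-elim (≤ˡ⇒≯ˡ {θ} {w′} (≤ˡ-trans θ w w′ θ≤w w≤w′) w′<θ)
block-mono {θ} {w = w} {w′} (a-above _ θ≤w) (a-marked _ _ w′<θ) w≤w′ =
  ⊥-elim (≤ˡ⇒≯ˡ {θ} {w′} (≤ˡ-trans θ w w′ θ≤w w≤w′) w′<θ)
block-mono {R = R} (b-below last≡b w<θ) (b-below last′≡b w′<θ) w≤w′
  rewrite w<θ | w′<θ | last≡b | last′≡b = +-monoˡ-≤ 0 (*-monoʳ-≤ 2 (countBelow-mono R w≤w′))
block-mono {R = R} (b-below last≡b w<θ) (a-marked last′≡a _ w′<θ) w≤w′
  rewrite w<θ | w′<θ | last≡b | last′≡a = +-mono-≤ (*-monoʳ-≤ 2 (countBelow-mono R w≤w′)) z≤n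
block-mono {R = R} (a-marked last≡a _ w<θ) (a-marked last′≡a _ w′<θ) w≤w′
  rewrite w<θ | w′<θ | last≡a | last′≡a = +-monoˡ-≤ 1 (*-monoʳ-≤ 2 (countBelow-mono R w≤w′))
block-mono {R = R} {w} {w′} (a-marked last≡a w∈R w<θ) (b-below last′≡b w′<θ) w≤w′
  with lexLeq w′ w in w′?w
... | true with () ← trans (sym last≡a)
                            (subst (λ v → lastL v ≡ b ∷ []) (sym (≤ˡ-antisym w w′ w≤w′ w′?w)) last′≡b)
... | false rewrite w<θ | w′<θ | last≡a | last′≡b = odd<even (countBelow-< R w∈R w′?w)

data Ladder (Q : List Word) (θ : Word) : Word → List Word → Set where
  top  : ∀ {e} → e <ˡ θ → Ladder Q θ e []
  step : ∀ {e r e′ rs} → e <ˡ r → r ∈ Q → lastL r ≡ a ∷ [] →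
         r <ˡ e′ → e′ ∈ Q → lastL e′ ≡ b ∷ [] → Ladder Q θ e′ rs → Ladder Q θ e (r ∷ rs)

ladder-<θ : ∀ {Q θ e rs} → Ladder Q θ e rs → e <ˡ θ
ladder-<θ (top e<θ) = e<θ
ladder-<θ {θ = θ} (step {e} {r} {e′} e<r _ _ r<e′ _ _ ladder) =
  <ˡ-trans e r θ e<r (<ˡ-trans r e′ θ r<e′ (ladder-<θ ladder))

ladder-base-< : ∀ {Q θ e rs} → Ladder Q θ e rs → All (e <ˡ_) rs
ladder-base-< (top _) = []
ladder-base-< (step {e} {r} {e′} e<r _ _ r<e′ _ _ ladder) =
  e<r ∷ All.map (λ {x} e′<x → <ˡ-trans e r x e<r (<ˡ-trans r e′ x r<e′ e′<x)) (ladder-base-< ladder)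

ladder-rungs-<θ : ∀ {Q θ e rs} → Ladder Q θ e rs → All (_<ˡ θ) rs
ladder-rungs-<θ (top _) = []
ladder-rungs-<θ {θ = θ} (step {r = r} {e′} _ _ _ r<e′ _ _ ladder) =
  <ˡ-trans r e′ θ r<e′ (ladder-<θ ladder) ∷ ladder-rungs-<θ ladder

ladder-covers : ∀ {Q θ e rs} → Ladder Q θ e rs → e ∈ Q → lastL e ≡ b ∷ [] →
  ∀ {m} → m ≤ 2 * length rs →
  ∃[ c ] c ∈ Q × e ≤ˡ c × c <ˡ θ × 2 * countBelow c rs + letterBit (lastL c) ≡ m
ladder-covers {e = e} (top e<θ) e∈Q last≡b z≤n =
  e , e∈Q , ≤ˡ-refl e , e<θ , cong letterBit last≡b
ladder-covers {θ = θ} {e} {r ∷ rs} ladder@(step e<r r∈Q last-r r<e′ _ _ _) e∈Q last≡b {zero} _ =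
  e , e∈Q , ≤ˡ-refl e , ladder-<θ ladder ,
  cong₂ (λ n bit → 2 * n + bit) (countBelow-≡0 {e} (r ∷ rs) (All.map (<ˡ⇒≤ˡ e _) (ladder-base-< ladder)))
                                  (cong letterBit last≡b)
ladder-covers {θ = θ} {e} {r ∷ rs} (step {e′ = e′} e<r r∈Q last-r r<e′ _ _ ladder) _ _ {suc zero} _ =
  r , r∈Q , <ˡ⇒≤ˡ e r e<r , <ˡ-trans r e′ θ r<e′ (ladder-<θ ladder) ,
  cong₂ (λ n bit → 2 * n + bit) (countBelow-≡0 {r} (r ∷ rs) r≤rs) (cong letterBit last-r)
  where
  r≤rs : All (r ≤ˡ_) (r ∷ rs)
  r≤rs = ≤ˡ-refl r ∷ All.map (λ {x} e′<x → <ˡ⇒≤ˡ r x (<ˡ-trans r e′ x r<e′ e′<x))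
                              (ladder-base-< ladder)
ladder-covers {θ = θ} {e} {r ∷ rs} (step {e′ = e′} e<r _ _ r<e′ e′∈Q last-e′ ladder) _ _ {suc (suc m)} m+2≤
  with ladder-covers ladder e′∈Q last-e′
         (≤-pred (≤-pred (subst (suc (suc m) ≤_) (double-suc (length rs)) m+2≤)))
... | c , c∈Q , e′≤c , c<θ , weight≡m =
  c , c∈Q , <ˡ⇒≤ˡ e c e<c , c<θ , weight-suc
  where
  r<c : r <ˡ c
  r<c = <ˡ-≤ˡ-trans r e′ c r<e′ e′≤c
  e<c : e <ˡ c
  e<c = <ˡ-trans e r c e<r r<c
  weight-suc : 2 * countBelow c (r ∷ rs) + letterBit (lastL c) ≡ suc (suc m)
  weight-suc rewrite r<c = trans (cong (_+ letterBit (lastL c)) (double-suc (countBelow c rs)))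
                                 (cong (λ n → suc (suc n)) weight≡m)

concatLast-map : ∀ (f : Word → Letter) {ws} → All (λ w → lastL w ≡ f w ∷ []) ws → concatLast ws ≡ map f ws
concatLast-map f []                   = refl
concatLast-map f (last≡ ∷ lasts) rewrite last≡ = cong (f _ ∷_) (concatLast-map f lasts)

sorted-blocks : ∀ {θ R ws} → Sorted ws → All (Placed θ R) ws → Linked _≤_ (map (block θ R) ws)
sorted-blocks []          []             = []
sorted-blocks [-]         _              = [-]
sorted-blocks (w≤v ∷ s)   (pw ∷ pv ∷ ps) = block-mono pw pv w≤v ∷ sorted-blocks s (pv ∷ ps)

runs-concatLast-sort : ∀ {θ e} Q R → (∀ {w} → w ∈ Q → Placed θ R w) → θ ∈ Q →
  e ∈ Q → lastL e ≡ b ∷ [] → Ladder Q θ e R → runs (concatLast (sort Q)) ≡ 2 * length R + 2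
runs-concatLast-sort {θ} Q R placed θ∈Q e∈Q last-e ladder = begin
  runs (concatLast (sort Q))
    ≡⟨ cong runs (concatLast-map (parity ∘ block θ R) (All.map lastL-block placedS)) ⟩
  runs (map (parity ∘ block θ R) (sort Q))
    ≡⟨ cong runs (map-∘ (sort Q)) ⟩
  runs (map parity (map (block θ R) (sort Q)))
    ≡⟨ runs-parity-covering _ (sorted-blocks (sort-sorted Q) placedS) bounded covered ⟩
  suc (suc (2 * length R))
    ≡⟨ +-comm 2 (2 * length R) ⟩
  2 * length R + 2
    ∎
  where
  ∈-sort : ∀ {w} → w ∈ Q → w ∈ sort Q
  ∈-sort = ∈-resp-↭ (↭-sym (sort-↭ Q))
  placedS : All (Placed θ R) (sort Q)
  placedS = All.tabulate (λ w∈ → placed (∈-resp-↭ (sort-↭ Q) w∈))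
  bounded : All (_≤ suc (2 * length R)) (map (block θ R) (sort Q))
  bounded = All.map⁺ (All.universal (block-≤ θ R) (sort Q))
  covered : ∀ {m} → m ≤ suc (2 * length R) → m ∈ map (block θ R) (sort Q)
  covered m≤ with m≤n⇒m<n∨m≡n m≤
  ... | inj₂ refl =
    subst (_∈ map (block θ R) (sort Q)) (block-above θ R θ (≤ˡ-refl θ)) (∈-map⁺ _ (∈-sort θ∈Q))
  ... | inj₁ m< with ladder-covers ladder e∈Q last-e (m<1+n⇒m≤n m<)
  ...   | c , c∈Q , _ , c<θ , weight≡m =
    subst (_∈ map (block θ R) (sort Q)) (trans (block-below θ R c c<θ) weight≡m) (∈-map⁺ _ (∈-sort c∈Q))

rotN : ℕ → Word → Word
rotN zero    w = w
rotN (suc i) w = rotN i (rot w)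

∈-rotsN⁻ : ∀ m t {w} → w ∈ rotsN m t → ∃[ i ] i < m × w ≡ rotN i t
∈-rotsN⁻ (suc m) t (here w≡t) = zero , s≤s z≤n , w≡t
∈-rotsN⁻ (suc m) t (there w∈) with ∈-rotsN⁻ m (rot t) w∈
... | i , i<m , w≡ = suc i , s≤s i<m , w≡

∈-rotsN⁺ : ∀ m t {i} → i < m → rotN i t ∈ rotsN m t
∈-rotsN⁺ (suc m) t {zero}  _         = here refl
∈-rotsN⁺ (suc m) t {suc i} (s≤s i<m) = there (∈-rotsN⁺ m (rot t) i<m)

rotN-++ : ∀ α β → rotN (length α) (α ++ β) ≡ β ++ α
rotN-++ []      β = sym (++-identityʳ β)
rotN-++ (x ∷ α) β = begin
  rotN (length α) ((α ++ β) ++ x ∷ [])  ≡⟨ cong (rotN (length α)) (++-assoc α β (x ∷ [])) ⟩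
  rotN (length α) (α ++ β ++ x ∷ [])    ≡⟨ rotN-++ α (β ++ x ∷ []) ⟩
  (β ++ x ∷ []) ++ α                    ≡⟨ ++-assoc β (x ∷ []) α ⟩
  β ++ x ∷ α                            ∎

data Conjugate (u : Word) (y : Letter) : Word → Set where
  whole : Conjugate u y (u ++ y ∷ [])
  after : ∀ p x v → u ≡ p ++ x ∷ v → Conjugate u y (v ++ y ∷ p ++ x ∷ [])

split-conjugate : ∀ {u y} α β → α ++ β ≡ u → Conjugate u y (β ++ y ∷ α)
split-conjugate α β eq with initLast α
split-conjugate .[]         β refl | []       = whole
split-conjugate .(p ∷ʳ x)   β refl | p ∷ʳ′ x  = after p x β (∷ʳ-++ p x β)

rotN-++-∷ʳ : ∀ α β y → rotN (length α) ((α ++ β) ∷ʳ y) ≡ β ++ y ∷ α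
rotN-++-∷ʳ α β y = begin
  rotN (length α) ((α ++ β) ∷ʳ y)   ≡⟨ cong (rotN (length α)) (++-assoc α β (y ∷ [])) ⟩
  rotN (length α) (α ++ β ∷ʳ y)     ≡⟨ rotN-++ α (β ∷ʳ y) ⟩
  (β ∷ʳ y) ++ α                     ≡⟨ ∷ʳ-++ β y α ⟩
  β ++ y ∷ α                        ∎

length-∷ʳ : ∀ (u : Word) y → length (u ∷ʳ y) ≡ suc (length u)
length-∷ʳ u y = trans (length-++ u) (+-comm (length u) 1)

conjugate-view : ∀ u y {w} → w ∈ conjugates (u ∷ʳ y) → Conjugate u y w
conjugate-view u y w∈ with ∈-rotsN⁻ (length (u ∷ʳ y)) (u ∷ʳ y) w∈
... | i , i<len , refl = subst (Conjugate u y) (sym rotation)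
                           (split-conjugate (take i u) (drop i u) (take++drop≡id i u))
  where
  |take|≡i : length (take i u) ≡ i
  |take|≡i = trans (length-take i u) (m≤n⇒m⊓n≡m (m<1+n⇒m≤n (subst (i <_) (length-∷ʳ u y) i<len)))
  rotation : rotN i (u ∷ʳ y) ≡ drop i u ++ y ∷ take i u
  rotation = begin
    rotN i (u ∷ʳ y)
      ≡⟨ cong₂ (λ n v → rotN n (v ∷ʳ y)) (sym |take|≡i) (sym (take++drop≡id i u)) ⟩
    rotN (length (take i u)) ((take i u ++ drop i u) ∷ʳ y)
      ≡⟨ rotN-++-∷ʳ (take i u) (drop i u) y ⟩
    drop i u ++ y ∷ take i u
      ∎

conjugate-∈ : ∀ {u y} p x v → u ≡ p ++ x ∷ v → v ++ y ∷ p ++ x ∷ [] ∈ conjugates (u ∷ʳ y)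
conjugate-∈ {u} {y} p x v refl =
  subst (_∈ conjugates (u ∷ʳ y)) rotation (∈-rotsN⁺ (length (u ∷ʳ y)) (u ∷ʳ y) i<len)
  where
  rotation : rotN (length (p ∷ʳ x)) (u ∷ʳ y) ≡ v ++ y ∷ p ++ x ∷ []
  rotation = trans (cong (λ w → rotN (length (p ∷ʳ x)) (w ∷ʳ y)) (sym (∷ʳ-++ p x v)))
                   (rotN-++-∷ʳ (p ∷ʳ x) v y)
  i<len : length (p ∷ʳ x) < length (u ∷ʳ y)
  i<len = subst (length (p ∷ʳ x) <_) (sym (trans (length-∷ʳ u y) (cong (suc ∘ length) (sym (∷ʳ-++ p x v)))))
            (s≤s (length-++-≤ˡ (p ∷ʳ x)))

whole-∈ : ∀ u y → u ∷ʳ y ∈ conjugates (u ∷ʳ y)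
whole-∈ []      y = here refl
whole-∈ (x ∷ u) y = here refl

φ : Word → Word
φ []      = []
φ (a ∷ w) = a ∷ b ∷ φ w
φ (b ∷ w) = a ∷ φ w

φ² : Word → Word
φ² w = φ (φ w)

φ-++ : ∀ u v → φ (u ++ v) ≡ φ u ++ φ v
φ-++ []      v = refl
φ-++ (a ∷ u) v = cong (λ w → a ∷ b ∷ w) (φ-++ u v)
φ-++ (b ∷ u) v = cong (a ∷_) (φ-++ u v)

φ²-++ : ∀ u v → φ² (u ++ v) ≡ φ² u ++ φ² v
φ²-++ u v = trans (cong φ (φ-++ u v)) (φ-++ (φ u) (φ v))

fibWord-suc : ∀ n → fibWord (suc n) ≡ φ (fibWord n)
fibWord-suc zero          = refl
fibWord-suc (suc zero)    = refl
fibWord-suc (suc (suc n)) =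
  trans (cong₂ _++_ (fibWord-suc (suc n)) (fibWord-suc n)) (sym (φ-++ (fibWord (suc n)) (fibWord n)))

φ²-++-a : ∀ w z → ∃[ T ] φ² w ++ a ∷ z ≡ a ∷ T
φ²-++-a []      z = z , refl
φ²-++-a (a ∷ w) z = _ , refl
φ²-++-a (b ∷ w) z = _ , refl

φ²-++-ab : ∀ w z → ∃[ T ] φ² w ++ a ∷ b ∷ z ≡ a ∷ b ∷ T
φ²-++-ab []      z = z , refl
φ²-++-ab (a ∷ w) z = _ , refl
φ²-++-ab (b ∷ w) z = _ , refl

φ²-∷ʳ-ab : ∀ w → ∃[ T ] φ² (w ∷ʳ a) ∷ʳ a ≡ a ∷ b ∷ T
φ²-∷ʳ-ab []      = _ , refl
φ²-∷ʳ-ab (a ∷ w) = _ , refl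
φ²-∷ʳ-ab (b ∷ w) = _ , refl

centralStep : Word → Word
centralStep c = φ² c ++ a ∷ b ∷ a ∷ []

-- The central words: the Fibonacci words of orders 2j+2 and 2j+3 without their last two letters.
centralEven centralOdd : ℕ → Word
centralEven zero    = []
centralEven (suc j) = centralStep (centralEven j)
centralOdd zero    = a ∷ []
centralOdd (suc j) = centralStep (centralOdd j)

fibInit : ℕ → Word
fibInit J = centralEven J ∷ʳ a

centralStep-∷ʳ : ∀ c → centralStep c ∷ʳ a ≡ φ² (c ∷ʳ a) ∷ʳ a
centralStep-∷ʳ c = cong (_∷ʳ a) (sym (φ²-++ c (a ∷ [])))

fibInit-suc : ∀ J → fibInit (suc J) ≡ φ² (fibInit J) ∷ʳ a
fibInit-suc J = centralStep-∷ʳ (centralEven J)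

fibWord-even : ∀ J → fibWord (2 * suc J) ≡ centralEven J ++ a ∷ b ∷ []
fibWord-even zero    = refl
fibWord-even (suc J) = begin
  fibWord (2 * suc (suc J))                    ≡⟨ cong fibWord (double-suc (suc J)) ⟩
  fibWord (suc (suc (2 * suc J)))              ≡⟨ fibWord-suc (suc (2 * suc J)) ⟩
  φ (fibWord (suc (2 * suc J)))                ≡⟨ cong φ (fibWord-suc (2 * suc J)) ⟩
  φ² (fibWord (2 * suc J))                     ≡⟨ cong φ² (fibWord-even J) ⟩
  φ² (centralEven J ++ a ∷ b ∷ [])             ≡⟨ φ²-++ (centralEven J) (a ∷ b ∷ []) ⟩
  φ² (centralEven J) ++ a ∷ b ∷ a ∷ a ∷ b ∷ [] ≡⟨ ++-assoc (φ² (centralEven J)) (a ∷ b ∷ a ∷ []) _ ⟨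
  centralEven (suc J) ++ a ∷ b ∷ []            ∎

dropLast-∷ʳ : ∀ w (x : Letter) → dropLast (w ∷ʳ x) ≡ w
dropLast-∷ʳ []          x = refl
dropLast-∷ʳ (y ∷ [])    x = refl
dropLast-∷ʳ (y ∷ z ∷ w) x = cong (y ∷_) (dropLast-∷ʳ (z ∷ w) x)

dropLast-fibWord : ∀ J → dropLast (fibWord (2 * suc J)) ≡ fibInit J
dropLast-fibWord J = trans (cong dropLast (trans (fibWord-even J) (sym (∷ʳ-++ (centralEven J) a (b ∷ [])))))
                           (dropLast-∷ʳ (fibInit J) b)

φ²-init : Letter → Word
φ²-init a = a ∷ b ∷ []
φ²-init b = a ∷ []

φ²-factor : ∀ p x v → φ² (p ++ x ∷ v) ∷ʳ a ≡ (φ² p ++ φ²-init x) ++ x ∷ φ² v ∷ʳ a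
φ²-factor p x v = begin
  φ² (p ++ x ∷ v) ∷ʳ a                    ≡⟨ cong (_∷ʳ a) (φ²-++ p (x ∷ v)) ⟩
  (φ² p ++ φ² (x ∷ v)) ∷ʳ a               ≡⟨ ++-assoc (φ² p) _ (a ∷ []) ⟩
  φ² p ++ φ² (x ∷ v) ∷ʳ a                 ≡⟨ cong (φ² p ++_) (letter-image x) ⟩
  φ² p ++ φ²-init x ++ x ∷ φ² v ∷ʳ a      ≡⟨ ++-assoc (φ² p) (φ²-init x) _ ⟨
  (φ² p ++ φ²-init x) ++ x ∷ φ² v ∷ʳ a    ∎
  where
  letter-image : ∀ x → φ² (x ∷ v) ∷ʳ a ≡ φ²-init x ++ x ∷ φ² v ∷ʳ a
  letter-image a = refl
  letter-image b = refl

fibInit-suc-end : ∀ J → fibInit (suc J) ≡ φ² (centralEven J) ++ a ∷ b ∷ a ∷ a ∷ []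
fibInit-suc-end J = ++-assoc (φ² (centralEven J)) (a ∷ b ∷ a ∷ []) (a ∷ [])

-- The J = 0 clauses are junk: there is no j < 0.
prefixEven prefixOdd : ℕ → ℕ → Word
prefixEven zero    _       = []
prefixEven (suc J) zero    = φ² (centralEven J) ++ a ∷ b ∷ []
prefixEven (suc J) (suc j) = φ² (prefixEven J j) ++ a ∷ b ∷ []
prefixOdd zero    _       = []
prefixOdd (suc J) zero    = φ² (centralEven J) ++ a ∷ []
prefixOdd (suc J) (suc j) = φ² (prefixOdd J j) ++ a ∷ []

fibInit-border : ∀ {J j} → j < J → fibInit J ≡ prefixEven J j ++ a ∷ fibInit j
fibInit-border {suc J} {zero}  _ =
  trans (fibInit-suc-end J) (sym (++-assoc (φ² (centralEven J)) (a ∷ b ∷ []) (a ∷ a ∷ [])))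
fibInit-border {suc J} {suc j} (s≤s j<J) = begin
  fibInit (suc J)                                        ≡⟨ fibInit-suc J ⟩
  φ² (fibInit J) ∷ʳ a                                    ≡⟨ cong (λ w → φ² w ∷ʳ a) (fibInit-border j<J) ⟩
  φ² (prefixEven J j ++ a ∷ fibInit j) ∷ʳ a              ≡⟨ φ²-factor (prefixEven J j) a (fibInit j) ⟩
  prefixEven (suc J) (suc j) ++ a ∷ φ² (fibInit j) ∷ʳ a  ≡⟨ cong (λ w → P ++ a ∷ w) (fibInit-suc j) ⟨
  prefixEven (suc J) (suc j) ++ a ∷ fibInit (suc j)      ∎
  where
  P : Word
  P = prefixEven (suc J) (suc j)

fibInit-odd : ∀ {J j} → j < J → fibInit J ≡ prefixOdd J j ++ b ∷ centralOdd j ∷ʳ a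
fibInit-odd {suc J} {zero}  _ =
  trans (fibInit-suc-end J) (sym (++-assoc (φ² (centralEven J)) (a ∷ []) (b ∷ a ∷ a ∷ [])))
fibInit-odd {suc J} {suc j} (s≤s j<J) = begin
  fibInit (suc J)                                               ≡⟨ fibInit-suc J ⟩
  φ² (fibInit J) ∷ʳ a                                           ≡⟨ cong (λ w → φ² w ∷ʳ a) (fibInit-odd j<J) ⟩
  φ² (prefixOdd J j ++ b ∷ centralOdd j ∷ʳ a) ∷ʳ a              ≡⟨ φ²-factor (prefixOdd J j) b _ ⟩
  prefixOdd (suc J) (suc j) ++ b ∷ φ² (centralOdd j ∷ʳ a) ∷ʳ a  ≡⟨ cong (λ w → P ++ b ∷ w) (centralStep-∷ʳ _) ⟨
  prefixOdd (suc J) (suc j) ++ b ∷ centralOdd (suc j) ∷ʳ a      ∎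
  where
  P : Word
  P = prefixOdd (suc J) (suc j)

data φ²Split (u : Word) : Letter → Word → Set where
  end    : φ²Split u a []
  image  : ∀ {p x v} → u ≡ p ++ x ∷ v → φ²Split u x (φ² v ∷ʳ a)
  first  : ∀ {v} → φ²Split u a (b ∷ v)
  middle : ∀ {v} → φ²Split u b (a ∷ φ² v ∷ʳ a)

φ²Split-∷ : ∀ {u x v} y → φ²Split u x v → φ²Split (y ∷ u) x v
φ²Split-∷ y end         = end
φ²Split-∷ y (image {p} u≡) = image {p = y ∷ p} (cong (y ∷_) u≡)
φ²Split-∷ y first       = first
φ²Split-∷ y middle      = middle

φ²-split : ∀ u {p x v} → φ² u ∷ʳ a ≡ p ++ x ∷ v → φ²Split u x v
φ²-split []      {[]}                    refl = end
φ²-split []      {_ ∷ []}                ()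
φ²-split []      {_ ∷ _ ∷ _}             ()
φ²-split (a ∷ u) {[]}                    refl = first
φ²-split (a ∷ u) {_ ∷ []}                refl = middle
φ²-split (a ∷ u) {_ ∷ _ ∷ []}            refl = image {p = []} refl
φ²-split (a ∷ u) {_ ∷ _ ∷ _ ∷ p}         eq   =
  φ²Split-∷ a (φ²-split u (∷-injectiveʳ (∷-injectiveʳ (∷-injectiveʳ eq))))
φ²-split (b ∷ u) {[]}                    refl = first
φ²-split (b ∷ u) {_ ∷ []}                refl = image {p = []} refl
φ²-split (b ∷ u) {_ ∷ _ ∷ p}             eq   =
  φ²Split-∷ b (φ²-split u (∷-injectiveʳ (∷-injectiveʳ eq)))

-- Mismatches survive φ² as long as the larger word does not end right after its mismatching b.
φ²-≺ : ∀ {u v} → u ≺ v → ∃[ v₀ ] v ≡ v₀ ∷ʳ a → φ² u ∷ʳ a ≺ φ² v ∷ʳ a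
φ²-≺ this                (b ∷ v₀ , refl) with φ²-++-a _ [] | φ²-∷ʳ-ab v₀
... | T , a∷T | T′ , ab∷T′ =
  subst₂ _≺_ (cong (λ w → a ∷ b ∷ a ∷ w) (sym a∷T)) (cong (λ w → a ∷ b ∷ w) (sym ab∷T′)) (next (next (next this)))
φ²-≺ (next {a} ())       ([] , refl)
φ²-≺ (next {a} u≺v)      (_ ∷ v₀ , refl) = next (next (next (φ²-≺ u≺v (v₀ , refl))))
φ²-≺ (next {b} u≺v)      (_ ∷ v₀ , refl) = next (next (φ²-≺ u≺v (v₀ , refl)))

≺-≢[] : ∀ {u v} → u ≺ v → v ≢ []
≺-≢[] this     ()
≺-≢[] (next _) ()

suffix-∷ʳ : ∀ {w p : Word} {x y : Letter} v → w ∷ʳ y ≡ p ++ x ∷ v → v ≢ [] →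
  ∃[ v₀ ] v ≡ v₀ ∷ʳ y
suffix-∷ʳ v eq v≢[] with initLast v
... | []        = ⊥-elim (v≢[] refl)
suffix-∷ʳ {w} {p} {x} {y} .(v₀ ∷ʳ z) eq _ | v₀ ∷ʳ′ z =
  v₀ , cong (v₀ ∷ʳ_) (sym (∷ʳ-injectiveʳ w (p ++ x ∷ v₀) (trans eq (sym (++-assoc p (x ∷ v₀) _)))))

fibInit-head : ∀ J → ∃[ X ] fibInit J ≡ a ∷ X
fibInit-head zero    = [] , refl
fibInit-head (suc J) with φ²-++-a (centralEven J) (b ∷ a ∷ [])
... | T , eq = T ∷ʳ a , cong (_∷ʳ a) eq

fibInit-suc-head : ∀ J → ∃[ Y ] fibInit (suc J) ≡ a ∷ b ∷ a ∷ Y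
fibInit-suc-head J with fibInit-head J
... | X , eq = φ² X ∷ʳ a , trans (fibInit-suc J) (cong (λ w → φ² w ∷ʳ a) eq)

data SuffixShape (J : ℕ) : Letter → Word → Set where
  empty  : ∀ {x} → SuffixShape J x []
  below  : ∀ {v} → v ≺ fibInit J → SuffixShape J b v
  above  : ∀ {v} → fibInit J ≺ v → SuffixShape J a v
  border : ∀ {j} → j < J → SuffixShape J a (fibInit j)

suffix-shape : ∀ J {p x v} → fibInit J ≡ p ++ x ∷ v → SuffixShape J x v
suffix-shape zero    {[]}        refl = empty
suffix-shape zero    {_ ∷ []}    ()
suffix-shape zero    {_ ∷ _ ∷ _} ()
suffix-shape (suc J) eq with φ²-split (fibInit J) (trans (sym (fibInit-suc J)) eq) | fibInit-suc-head J
... | end    | _ = empty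
... | first  | Y , aba∷Y = above (subst (_≺ _) (sym aba∷Y) this)
... | middle {v} | Y , aba∷Y with φ²-++-a v []
...   | T , a∷T = below (subst₂ _≺_ (cong (a ∷_) (sym a∷T)) (sym aba∷Y) (next this))
suffix-shape (suc J) eq | image {p} {x} {v} eq′ | _ with suffix-shape J eq′
... | empty with refl ← ∷ʳ-injectiveʳ (centralEven J) p eq′ = border (s≤s z≤n)
... | below v≺ = below (subst (_ ≺_) (sym (fibInit-suc J)) (φ²-≺ v≺ (centralEven J , refl)))
... | above ≺v =
  above (subst (_≺ _) (sym (fibInit-suc J)) (φ²-≺ ≺v (suffix-∷ʳ v eq′ (≺-≢[] ≺v))))
... | border {j} j<J = subst (SuffixShape (suc J) a) (fibInit-suc j) (border (s≤s j<J))

s′ : ℕ → Word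
s′ J = fibInit J ∷ʳ a

borderConj oddConj : ℕ → ℕ → Word
borderConj J j = fibInit j ++ a ∷ prefixEven J j ∷ʳ a
oddConj    J j = (centralOdd j ∷ʳ a) ++ a ∷ prefixOdd J j ∷ʳ b

lastL-∷ʳ : ∀ w (x : Letter) → lastL (w ∷ʳ x) ≡ x ∷ []
lastL-∷ʳ []          x = refl
lastL-∷ʳ (y ∷ [])    x = refl
lastL-∷ʳ (y ∷ z ∷ w) x = lastL-∷ʳ (z ∷ w) x

lastL-conjugate : ∀ v y p (x : Letter) → lastL (v ++ y ∷ p ∷ʳ x) ≡ x ∷ []
lastL-conjugate v y p x = trans (cong lastL (sym (++-assoc v (y ∷ p) (x ∷ [])))) (lastL-∷ʳ (v ++ y ∷ p) x)

conjugate-placed : ∀ J {R} → a ∷ fibInit J ∈ R → (∀ {j} → j < J → borderConj J j ∈ R) →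
  All (_<ˡ s′ J) R → ∀ {w} → w ∈ conjugates (s′ J) → Placed (s′ J) R w
conjugate-placed J {R} rot∈R border∈R R<s′ w∈ with conjugate-view (fibInit J) a w∈
... | whole = a-above (lastL-∷ʳ (fibInit J) a) (≤ˡ-refl (s′ J))
... | after p x v eq with suffix-shape J eq
...   | empty with refl , refl ← ∷ʳ-injective (centralEven J) p eq =
  a-marked (lastL-conjugate [] a (centralEven J) a) rot∈R (All.lookup R<s′ rot∈R)
...   | below v≺ = b-below (lastL-conjugate v a p b) (≺⇒<ˡ (≺-++ʳ _ (a ∷ []) v≺))
...   | above ≺v = a-above (lastL-conjugate v a p a) (<ˡ⇒≤ˡ (s′ J) _ (≺⇒<ˡ (≺-++ʳ (a ∷ []) _ ≺v)))
...   | border j<J with refl ← ++-cancelʳ (a ∷ v) p (prefixEven J _) (trans (sym eq) (fibInit-border j<J)) =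
  a-marked (lastL-conjugate v a p a) (border∈R j<J) (All.lookup R<s′ (border∈R j<J))

centralOdd-extends : ∀ j → ∃[ y ] centralOdd (suc j) ∷ʳ a ≡ fibInit (suc j) ++ b ∷ y
centralOdd-extends zero    = a ∷ a ∷ [] , refl
centralOdd-extends (suc j) with centralOdd-extends j
... | y , eq = φ² y ∷ʳ a , (begin
  centralOdd (suc (suc j)) ∷ʳ a                 ≡⟨ centralStep-∷ʳ (centralOdd (suc j)) ⟩
  φ² (centralOdd (suc j) ∷ʳ a) ∷ʳ a             ≡⟨ cong (λ w → φ² w ∷ʳ a) eq ⟩
  φ² (fibInit (suc j) ++ b ∷ y) ∷ʳ a            ≡⟨ φ²-factor (fibInit (suc j)) b y ⟩
  φ² (fibInit (suc j)) ∷ʳ a ++ b ∷ φ² y ∷ʳ a    ≡⟨ cong (_++ b ∷ φ² y ∷ʳ a) (fibInit-suc (suc j)) ⟨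
  fibInit (suc (suc j)) ++ b ∷ φ² y ∷ʳ a        ∎)

centralOdd≺fibInit : ∀ j → centralOdd j ∷ʳ a ≺ fibInit (suc j)
centralOdd≺fibInit zero    = next this
centralOdd≺fibInit (suc j) = subst₂ _≺_ (sym (centralStep-∷ʳ (centralOdd j))) (sym (fibInit-suc (suc j)))
  (φ²-≺ (centralOdd≺fibInit j) (centralEven (suc j) , refl))

oddConj≺ : ∀ J j X → oddConj J j ≺ fibInit (suc j) ++ X
oddConj≺ J j X = ≺-++ʳ _ X (centralOdd≺fibInit j)

borderConj≺oddConj : ∀ J j → borderConj J (suc j) ≺ oddConj J (suc j)
borderConj≺oddConj J j with centralOdd-extends j
... | y , eq = subst (borderConj J (suc j) ≺_) (sym oddConj≡)
                 (≺-++ˡ (fibInit (suc j)) (this {v = y ++ a ∷ prefixOdd J (suc j) ∷ʳ b}))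
  where
  oddConj≡ : oddConj J (suc j) ≡ fibInit (suc j) ++ b ∷ y ++ a ∷ prefixOdd J (suc j) ∷ʳ b
  oddConj≡ = trans (cong (_++ a ∷ prefixOdd J (suc j) ∷ʳ b) eq) (++-assoc (fibInit (suc j)) (b ∷ y) _)

rungsFrom : ℕ → ℕ → ℕ → List Word
rungsFrom J j zero    = []
rungsFrom J j (suc n) = borderConj J j ∷ rungsFrom J (suc j) n

length-rungsFrom : ∀ J j n → length (rungsFrom J j n) ≡ n
length-rungsFrom J j zero    = refl
length-rungsFrom J j (suc n) = cong suc (length-rungsFrom J (suc j) n)

∈-rungsFrom : ∀ J {j k} n → j ≤ k → k < n + j → borderConj J k ∈ rungsFrom J j n
∈-rungsFrom J zero    j≤k k<j = ⊥-elim (<-irrefl refl (<-≤-trans k<j j≤k))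
∈-rungsFrom J {j} {k} (suc n) j≤k k<n+j with m≤n⇒m<n∨m≡n j≤k
... | inj₂ refl = here refl
... | inj₁ j<k  = there (∈-rungsFrom J n j<k (subst (k <_) (sym (+-suc n j)) k<n+j))

ladder-rung : ∀ {J e rs} j → suc j < J → e <ˡ borderConj J (suc j) →
  Ladder (conjugates (s′ J)) (s′ J) (oddConj J (suc j)) rs →
  Ladder (conjugates (s′ J)) (s′ J) e (borderConj J (suc j) ∷ rs)
ladder-rung {J} j j+1<J e< = step e<
  (conjugate-∈ _ _ _ (fibInit-border j+1<J)) (lastL-conjugate (fibInit (suc j)) a (prefixEven J (suc j)) a)
  (≺⇒<ˡ (borderConj≺oddConj J j))
  (conjugate-∈ _ _ _ (fibInit-odd j+1<J)) (lastL-conjugate (centralOdd (suc j) ∷ʳ a) a (prefixOdd J (suc j)) b)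

ladder-tail : ∀ {J} n j → n + suc j ≡ J →
  Ladder (conjugates (s′ J)) (s′ J) (oddConj J j) (rungsFrom J (suc j) n)
ladder-tail zero    j refl = top (≺⇒<ˡ (oddConj≺ (suc j) j (a ∷ [])))
ladder-tail {J} (suc n) j eq = ladder-rung j j+1<J (≺⇒<ˡ (oddConj≺ J j _))
  (ladder-tail n (suc j) (trans (+-suc n (suc j)) eq))
  where
  j+1<J : suc j < J
  j+1<J = subst (suc (suc j) ≤_) eq (s≤s (m≤n+m (suc j) n))

-- For J = m + 2 the a-ending conjugates below s′ J are, in increasing order, r₀ = borderConj J 0,
-- a ∷ fibInit J and borderConj J j (0 < j < J); b-ending conjugates separate them:
-- e₀ < r₀ < e₁ < a ∷ fibInit J < e₂ < borderConj J 1 < oddConj J 1 < ⋯ < oddConj J (J ∸ 1) < s′ J.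
module _ (m : ℕ) where
  private
    J : ℕ
    J = suc (suc m)

    Q : List Word
    Q = conjugates (s′ J)

    W : Word
    W = a ∷ a ∷ b ∷ a ∷ b ∷ a ∷ φ² (proj₁ (fibInit-suc-head m)) ∷ʳ a

    fibInit≡abW : fibInit J ≡ a ∷ b ∷ W
    fibInit≡abW = trans (fibInit-suc (suc m)) (cong (λ w → φ² w ∷ʳ a) (proj₂ (fibInit-suc-head m)))

    P₁ : Word
    P₁ = φ² (prefixEven (suc m) 0) ∷ʳ a

    fibInit≡P₁b : fibInit J ≡ P₁ ++ b ∷ a ∷ fibInit 1
    fibInit≡P₁b = trans (fibInit-border {J} {1} (s≤s (s≤s z≤n)))
      (trans (++-assoc (φ² (prefixEven (suc m) 0)) (a ∷ b ∷ []) _)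
             (sym (++-assoc (φ² (prefixEven (suc m) 0)) (a ∷ []) _)))

    e₀ r₀ e₁ e₂ : Word
    e₀ = oddConj J 0
    r₀ = borderConj J 0
    e₁ = (a ∷ fibInit 1) ++ a ∷ P₁ ∷ʳ b
    e₂ = W ++ a ∷ (a ∷ []) ∷ʳ b

    r₀≡aaab : ∃[ T ] r₀ ≡ a ∷ a ∷ a ∷ b ∷ T
    r₀≡aaab with φ²-++-ab (centralEven (suc m)) []
    ... | T , eq = T ∷ʳ a , cong (λ w → a ∷ a ∷ w ∷ʳ a) eq

    e₀≺r₀ : e₀ ≺ r₀
    e₀≺r₀ with φ²-++-a (centralEven (suc m)) [] | r₀≡aaab
    ... | T , eq | _ , r₀≡ =
      subst₂ _≺_ (cong (λ w → a ∷ a ∷ a ∷ w ∷ʳ b) (sym eq)) (sym r₀≡) (next (next (next this)))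

    r₀≺e₁ : r₀ ≺ e₁
    r₀≺e₁ = subst (_≺ e₁) (sym (proj₂ r₀≡aaab)) (next (next this))

    e₁≺a∷fibInit : e₁ ≺ a ∷ fibInit J
    e₁≺a∷fibInit = subst (e₁ ≺_) (cong (a ∷_) (sym fibInit≡abW)) (next (next (next (next (next this)))))

    a∷fibInit≺e₂ : a ∷ fibInit J ≺ e₂
    a∷fibInit≺e₂ = subst (_≺ e₂) (cong (a ∷_) (sym fibInit≡abW)) (next (next (next (next this))))

    e₂≺r₁ : e₂ ≺ borderConj J 1
    e₂≺r₁ = next this

    e₀∈Q : e₀ ∈ Q
    e₀∈Q = conjugate-∈ _ _ _ (fibInit-odd {J} {0} (s≤s z≤n))

    last-e₀ : lastL e₀ ≡ b ∷ []
    last-e₀ = lastL-conjugate (centralOdd 0 ∷ʳ a) a (prefixOdd J 0) b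

    R : List Word
    R = r₀ ∷ (a ∷ fibInit J) ∷ rungsFrom J 1 (suc m)

    ladder : Ladder Q (s′ J) e₀ R
    ladder =
      step (≺⇒<ˡ e₀≺r₀) r₀∈Q last-r₀ (≺⇒<ˡ r₀≺e₁) e₁∈Q last-e₁
     (step (≺⇒<ˡ e₁≺a∷fibInit) a∷fibInit∈Q last-a∷fibInit (≺⇒<ˡ a∷fibInit≺e₂) e₂∈Q last-e₂
     (ladder-rung {J} 0 (s≤s (s≤s z≤n)) (≺⇒<ˡ e₂≺r₁) (ladder-tail {J} m 1 (+-comm m 2))))
      where
      r₀∈Q : r₀ ∈ Q
      r₀∈Q = conjugate-∈ _ _ _ (fibInit-border {J} {0} (s≤s z≤n))
      last-r₀ : lastL r₀ ≡ a ∷ []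
      last-r₀ = lastL-conjugate (fibInit 0) a (prefixEven J 0) a
      e₁∈Q : e₁ ∈ Q
      e₁∈Q = conjugate-∈ _ _ _ fibInit≡P₁b
      last-e₁ : lastL e₁ ≡ b ∷ []
      last-e₁ = lastL-conjugate (a ∷ fibInit 1) a P₁ b
      a∷fibInit∈Q : a ∷ fibInit J ∈ Q
      a∷fibInit∈Q = conjugate-∈ (centralEven J) a [] refl
      last-a∷fibInit : lastL (a ∷ fibInit J) ≡ a ∷ []
      last-a∷fibInit = lastL-conjugate [] a (centralEven J) a
      e₂∈Q : e₂ ∈ Q
      e₂∈Q = conjugate-∈ (a ∷ []) b W fibInit≡abW
      last-e₂ : lastL e₂ ≡ b ∷ []
      last-e₂ = lastL-conjugate W a (a ∷ []) b

    border∈R : ∀ {j} → j < J → borderConj J j ∈ R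
    border∈R {zero}  _   = here refl
    border∈R {suc j} j<J =
      there (there (∈-rungsFrom J (suc m) (s≤s z≤n) (subst (suc j <_) (sym (+-comm (suc m) 1)) j<J)))

    placed : ∀ {w} → w ∈ Q → Placed (s′ J) R w
    placed = conjugate-placed J (there (here refl)) border∈R (ladder-rungs-<θ ladder)

  runs-BWT-s′ : runs (BWT (s′ (suc (suc m)))) ≡ 2 * suc (suc (suc m)) + 2
  runs-BWT-s′ = begin
    runs (BWT (s′ J))   ≡⟨ runs-concatLast-sort Q R placed (whole-∈ (fibInit J) a) e₀∈Q last-e₀ ladder ⟩
    2 * length R + 2    ≡⟨ cong (λ n → 2 * suc (suc n) + 2) (length-rungsFrom J 1 (suc m)) ⟩
    2 * suc J + 2       ∎

proposition5 : (k : ℕ) → 4 < 2 * k →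
    runs (BWT (dropLast (fibWord (2 * k)) ++ (a ∷ []))) ≡ 2 * k + 2
proposition5 zero                ()
proposition5 (suc zero)          (s≤s (s≤s ()))
proposition5 (suc (suc zero))    (s≤s (s≤s (s≤s (s≤s ()))))
proposition5 (suc (suc (suc m))) _ = begin
  runs (BWT (dropLast (fibWord (2 * suc J)) ∷ʳ a))  ≡⟨ cong (λ w → runs (BWT (w ∷ʳ a))) (dropLast-fibWord J) ⟩
  runs (BWT (s′ J))                                  ≡⟨ runs-BWT-s′ m ⟩
  2 * suc J + 2                                      ∎
  where
  J : ℕ
  J = suc (suc m)
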